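{- Let $a$ be a positive integer and let $\mathcal K$ be an $SL_2(\mathbb Z)$-equivalence class of binary quadratic forms (primitive or not) of discriminant $a^2+4$, and let $n$ be the sum of $\mathcal K$. Then $n\le a+1$, with equality if and only if $\mathcal K$ is the principal class, i.e. the class of $x^2+(a+2)xy+ay^2$.
   Context: Forms are $Ax^2+Bxy+Cy^2$ with integer coefficients, discriminant $B^2-4AC$; $SL_2(\mathbb Z)$ acts by $f(x,y)\mapsto f(\alpha x+\beta y,\gamma x+\delta y)$, and equivalence classes are orbits. A form is Zagier-reduced if $A>0$, $C>0$, $B>A+C$; every class of positive nonsquare discriminant contains Zagier-reduced forms. For a Zagier-reduced form $f=Ax^2+Bxy+Cy^2$ of discriminant $a^2+4$ with $a>0$, let $\psi(f)$ be the even-length sequence $(q_1,\dots,q_l)$ of positive partial quotients of the simple continued fraction expansion of $\frac{(a+B)/2}{A}$. The sum of the entries $q_1+\dots+q_l$ is the same for all Zagier-reduced forms in a given class; this common value is called the sum of the class. -}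

module Defs where

open import Data.Nat as ℕ using (ℕ; zero; suc)
open import Data.Integer as ℤ using (ℤ; +_)
open import Data.List using (List; []; _∷_; length)
open import Data.List.Relation.Unary.All using (All)
open import Data.Product using (_×_; _,_; ∃-syntax)
open import Data.Nat.Divisibility using (_∣_)
open import Relation.Binary.PropositionalEquality using (_≡_)

record Form : Set where
  constructor form
  field
    A B C : ℤ
open Form public

disc : Form → ℤ
disc f = B f ℤ.* B f ℤ.- (+ 4) ℤ.* A f ℤ.* C f

record Mat : Set where
  constructor mat
  field
    α β γ δ : ℤ
open Mat public

det : Mat → ℤ
det m = α m ℤ.* δ m ℤ.- β m ℤ.* γ m

-- f ↦ f(αx+βy, γx+δy), coefficients expanded.
act : Mat → Form → Form
act (mat a b c d) (form P Q R) = form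
  (P ℤ.* a ℤ.* a ℤ.+ Q ℤ.* a ℤ.* c ℤ.+ R ℤ.* c ℤ.* c)
  ((+ 2) ℤ.* P ℤ.* a ℤ.* b ℤ.+ Q ℤ.* (a ℤ.* d ℤ.+ b ℤ.* c) ℤ.+ (+ 2) ℤ.* R ℤ.* c ℤ.* d)
  (P ℤ.* b ℤ.* b ℤ.+ Q ℤ.* b ℤ.* d ℤ.+ R ℤ.* d ℤ.* d)

_∼_ : Form → Form → Set
f ∼ g = ∃[ m ] (det m ≡ + 1 × act m f ≡ g)

ZagierReduced : Form → Set
ZagierReduced f = (+ 0 ℤ.< A f) × (+ 0 ℤ.< C f) × (A f ℤ.+ C f ℤ.< B f)

principal : ℕ → Form
principal a = form (+ 1) (+ (a ℕ.+ 2)) (+ a)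

-- Numerator / denominator of the finite continued fraction [q₁; q₂, …, q_l]
-- (empty list = 1/0 as the usual base case): [q ∷ qs] = q + 1/[qs].
cf : List ℕ → ℕ × ℕ
cf [] = 1 , 0
cf (q ∷ qs) with cf qs
... | n , d = q ℕ.* n ℕ.+ d , n

-- ψ f qs : qs is the even-length sequence of positive partial quotients of
-- the simple continued fraction of ((a+B)/2)/A, i.e. value(qs) = (a+B)/(2A).
IsPsi : ℕ → Form → List ℕ → Set
IsPsi a f qs with cf qs
... | n , d = All (1 ℕ.≤_) qs × (2 ∣ length qs)
              × ((+ n) ℤ.* ((+ 2) ℤ.* A f) ≡ (+ d) ℤ.* ((+ a) ℤ.+ B f))

module Submission where

-- Let ψ(g) = (q₁, …, q_l), n = q₁ + … + q_l and M = ∏ (qᵢ 1; 1 0). As l is even and every qᵢ ≥ 1,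
-- M = R N L with R = (1 1; 0 1), L = (1 0; 1 1) and N = (x y; z w) a product of n - 2 factors R and L;
-- hence n - 2 ≤ y + z, with equality when x = 1. The first column of M is proportional to ((a + B)/2, A),
-- both ratios are in lowest terms, and reducedness pins down the rest: g = (z + w, a + 2w, y + w) with
-- a = x + y + z. So n ≤ y + z + 2 ≤ a + 1, with equality iff x = 1. If x = 1, an explicit matrix carries g
-- to the principal form. Conversely, a reduced form in the principal class represents 1, and a Euclidean
-- descent on the representing vector, which cannot stall because a² + 4 is not a square, forces
-- B = A + C + 1, that is x = 1.

module Arithmetic where

  open import Data.Nat
  open import Data.Nat.Properties
  open import Data.Nat.Tactic.RingSolver using (solve)
  open import Data.List.Base using (_∷_; [])
  open import Data.Product using (∃-syntax; _×_; _,_)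
  open import Data.Sum using (_⊎_; inj₁; inj₂)
  open import Relation.Binary.PropositionalEquality
  open import Relation.Nullary using (contradiction)

  even-or-odd : ∀ n → ∃[ q ] (n ≡ 2 * q ⊎ n ≡ suc (2 * q))
  even-or-odd zero = 0 , inj₁ refl
  even-or-odd (suc n) with even-or-odd n
  ... | q , inj₁ refl = q , inj₂ refl
  ... | q , inj₂ refl = suc q , inj₁ (cong suc (sym (+-suc q (q + 0))))

  +-difference : ∀ u v → (∃[ t ] v ≡ u + t) ⊎ (∃[ t ] u ≡ v + suc t)
  +-difference zero    v       = inj₁ (v , refl)
  +-difference (suc u) zero    = inj₂ (u , refl)
  +-difference (suc u) (suc v) with +-difference u v
  ... | inj₁ (t , refl) = inj₁ (t , refl)
  ... | inj₂ (t , refl) = inj₂ (t , refl)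

  square-cancel-< : ∀ {m n} → m * m < n * n → m < n
  square-cancel-< sq< = ≰⇒> λ n≤m → <⇒≱ sq< (*-mono-≤ n≤m n≤m)

  square-squeeze : ∀ m n → m * m < n * n → n * n < suc (suc m) * suc (suc m) → n ≡ suc m
  square-squeeze m n lo hi = ≤-antisym (m<1+n⇒m≤n (square-cancel-< hi)) (square-cancel-< lo)

  -- m² < m² + 4k < (m + 2)², so the square would be (m + 1)², but (m + 1)² - m² is odd.
  square≢square+4* : ∀ m n k → 0 < k → k ≤ m → n * n ≢ m * m + 4 * k
  square≢square+4* m n k 0<k k≤m n²≡ with square-squeeze m n lo hi
    where
    open ≤-Reasoning
    lo : m * m < n * n
    lo = begin-strict
      m * m          <⟨ m<m+n (m * m) (*-monoʳ-< 4 0<k) ⟩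
      m * m + 4 * k  ≡⟨ n²≡ ⟨
      n * n          ∎
    hi : n * n < suc (suc m) * suc (suc m)
    hi = begin-strict
      n * n                      ≡⟨ n²≡ ⟩
      m * m + 4 * k              ≤⟨ +-monoʳ-≤ (m * m) (*-monoʳ-≤ 4 k≤m) ⟩
      m * m + 4 * m              <⟨ m<m+n (m * m + 4 * m) z<s ⟩
      m * m + 4 * m + 4          ≡⟨ solve (m ∷ []) ⟩
      suc (suc m) * suc (suc m)  ∎
  ... | refl = even≢odd (2 * k) m (sym (+-cancelˡ-≡ (m * m) _ _ (begin
    m * m + suc (2 * m)        ≡⟨ solve (m ∷ []) ⟩
    suc m * suc m              ≡⟨ n²≡ ⟩
    m * m + 4 * k              ≡⟨ solve (m ∷ k ∷ []) ⟩
    m * m + 2 * (2 * k)        ∎)))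
    where open ≡-Reasoning

  a²+4-nonsquare : ∀ a t → 0 < a → t * t ≢ a * a + 4
  a²+4-nonsquare a t 0<a t²≡ = square≢square+4* a t 1 z<s 0<a t²≡

  b²≡a²+4+4c⇒b≡c+2 : ∀ a b c → b * b ≡ a * a + 4 + 4 * c → c + 2 ≤ b → b ≡ c + 2
  b²≡a²+4+4c⇒b≡c+2 a b c b²≡ c+2≤b with m≤n⇒∃[o]m+o≡n c+2≤b
  ... | j , refl = excess-vanishes j a²≡
    where
    open ≡-Reasoning
    a²≡ : a * a ≡ (c + j) * (c + j) + 4 * j
    a²≡ = +-cancelʳ-≡ (4 + 4 * c) _ _ (begin
      a * a + (4 + 4 * c)                  ≡⟨ +-assoc (a * a) 4 (4 * c) ⟨
      a * a + 4 + 4 * c                    ≡⟨ b²≡ ⟨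
      (c + 2 + j) * (c + 2 + j)            ≡⟨ solve (c ∷ j ∷ []) ⟩
      (c + j) * (c + j) + 4 * j + (4 + 4 * c) ∎)
    excess-vanishes : ∀ j → a * a ≡ (c + j) * (c + j) + 4 * j → c + 2 + j ≡ c + 2
    excess-vanishes zero    _   = +-identityʳ (c + 2)
    excess-vanishes (suc i) a²≡ = contradiction a²≡ (square≢square+4* (c + suc i) a (suc i) z<s (m≤n+m (suc i) c))

  b²≡a²+4n⇒b≡a+2q : ∀ a b n → b * b ≡ a * a + 4 * n → ∃[ q ] b ≡ a + 2 * q × (a + q) * q ≡ n
  b²≡a²+4n⇒b≡a+2q a b n b²≡ with m≤n⇒∃[o]m+o≡n a≤b
    where
    a≤b : a ≤ b
    a≤b = ≮⇒≥ λ b<a → <⇒≱ (*-mono-< b<a b<a) (subst (a * a ≤_) (sym b²≡) (m≤m+n (a * a) (4 * n)))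
  ... | t , refl with even-or-odd t
  ...   | q , inj₁ refl = q , refl , *-cancelˡ-≡ _ _ 4 (+-cancelˡ-≡ (a * a) _ _ (begin
    a * a + 4 * ((a + q) * q)  ≡⟨ solve (a ∷ q ∷ []) ⟩
    (a + 2 * q) * (a + 2 * q)  ≡⟨ b²≡ ⟩
    a * a + 4 * n              ∎))
    where open ≡-Reasoning
  ...   | q , inj₂ refl = contradiction (+-cancelˡ-≡ (a * a) _ _ (begin
    a * a + 2 * (2 * n)                    ≡⟨ solve (a ∷ n ∷ []) ⟩
    a * a + 4 * n                          ≡⟨ b²≡ ⟨
    (a + suc (2 * q)) * (a + suc (2 * q))  ≡⟨ solve (a ∷ q ∷ []) ⟩
    a * a + suc (2 * (a + 2 * a * q + 2 * q + 2 * q * q)) ∎)) (even≢odd (2 * n) r)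
    where
    open ≡-Reasoning
    r = a + 2 * a * q + 2 * q + 2 * q * q

module Signs where

  open import Data.Nat as ℕ using (suc; s≤s; z≤n)
  import Data.Nat.Properties as ℕ
  open import Data.Integer hiding (suc)
  open import Data.Integer.Properties using (abs-*; +-identityʳ; +-monoʳ-<)
  open import Data.Product using (_,_; ∃-syntax)
  open import Relation.Binary.PropositionalEquality

  0<⇒+[1+] : ∀ {i} → + 0 < i → ∃[ k ] i ≡ +[1+ k ]
  0<⇒+[1+] (+<+ (s≤s {n = k} z≤n)) = k , refl

  <0⇒-[1+] : ∀ {i} → i < + 0 → ∃[ k ] i ≡ -[1+ k ]
  <0⇒-[1+] (-<+ {m = k}) = k , refl

  0<+0< : ∀ {i j} → + 0 < i → + 0 < j → + 0 < i + j
  0<+0< (+<+ ℕ.z<s) (+<+ ℕ.z<s) = +<+ ℕ.z<s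

  <0+<0 : ∀ {i j} → i < + 0 → j < + 0 → i + j < + 0
  <0+<0 -<+ -<+ = -<+

  0<*≡1⇒≡1 : ∀ {i} j → + 0 < i → i * j ≡ + 1 → i ≡ + 1
  0<*≡1⇒≡1 j (+<+ (s≤s {n = k} z≤n)) ij≡1
    with ℕ.m*n≡1⇒m≡1 (suc k) ∣ j ∣ (trans (sym (abs-* +[1+ k ] j)) (cong ∣_∣ ij≡1))
  ... | refl = refl

  i<i+j : ∀ i {j} → + 0 < j → i < i + j
  i<i+j i 0<j = subst (_< i + _) (+-identityʳ i) (+-monoʳ-< i 0<j)

module Forms where

  open import Defs
  import Data.Nat as ℕ
  open import Data.Integer
  open import Data.Integer.Properties using (*-identityˡ; +-injective; pos-+; pos-*)
  open import Data.Integer.Tactic.RingSolver using (solve-∀)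
  open import Data.Product using (_,_; ∃₂)
  open import Relation.Binary.PropositionalEquality

  eval : Form → ℤ → ℤ → ℤ
  eval (form A B C) x y = A * x * x + B * x * y + C * y * y

  _·_ : Mat → Mat → Mat
  mat a b c d · mat e f g h = mat (a * e + b * g) (a * f + b * h) (c * e + d * g) (c * f + d * h)

  1ₘ : Mat
  1ₘ = mat (+ 1) (+ 0) (+ 0) (+ 1)

  adjugate : Mat → Mat
  adjugate (mat a b c d) = mat d (- b) (- c) a

  form-cong : ∀ {P P′ Q Q′ R R′} → P ≡ P′ → Q ≡ Q′ → R ≡ R′ → form P Q R ≡ form P′ Q′ R′
  form-cong refl refl refl = refl

  det-· : ∀ m n → det (m · n) ≡ det m * det n
  det-· (mat a b c d) (mat e f g h) = identity a b c d e f g h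
    where
    identity : ∀ a b c d e f g h →
      (a * e + b * g) * (c * f + d * h) - (a * f + b * h) * (c * e + d * g) ≡ (a * d - b * c) * (e * h - f * g)
    identity = solve-∀

  det-adjugate : ∀ m → det (adjugate m) ≡ det m
  det-adjugate (mat a b c d) = identity a b c d
    where
    identity : ∀ a b c d → d * a - (- b) * (- c) ≡ a * d - b * c
    identity = solve-∀

  mat-cong : ∀ {a a′ b b′ c c′ d d′} → a ≡ a′ → b ≡ b′ → c ≡ c′ → d ≡ d′ →
             mat a b c d ≡ mat a′ b′ c′ d′
  mat-cong refl refl refl refl = refl

  ·-adjugate : ∀ m → det m ≡ + 1 → m · adjugate m ≡ 1ₘ
  ·-adjugate (mat a b c d) det≡1 = mat-cong
    (trans (upper-left a b c d) det≡1) (upper-right a b) (lower-left c d) (trans (lower-right a b c d) det≡1)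
    where
    upper-left : ∀ a b c d → a * d + b * - c ≡ a * d - b * c
    upper-left = solve-∀
    upper-right : ∀ a b → a * - b + b * a ≡ + 0
    upper-right = solve-∀
    lower-left : ∀ c d → c * d + d * - c ≡ + 0
    lower-left = solve-∀
    lower-right : ∀ a b c d → c * - b + d * a ≡ a * d - b * c
    lower-right = solve-∀

  act-1ₘ : ∀ f → act 1ₘ f ≡ f
  act-1ₘ (form P Q R) = form-cong (first P Q R) (middle P Q R) (last P Q R)
    where
    first : ∀ P Q R → P * + 1 * + 1 + Q * + 1 * + 0 + R * + 0 * + 0 ≡ P
    first = solve-∀
    middle : ∀ P Q R → + 2 * P * + 1 * + 0 + Q * (+ 1 * + 1 + + 0 * + 0) + + 2 * R * + 0 * + 1 ≡ Q
    middle = solve-∀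
    last : ∀ P Q R → P * + 0 * + 0 + Q * + 0 * + 1 + R * + 1 * + 1 ≡ R
    last = solve-∀

  act-· : ∀ m n f → act (m · n) f ≡ act n (act m f)
  act-· (mat a b c d) (mat e f g h) (form P Q R) =
    form-cong (first a b c d e f g h P Q R) (middle a b c d e f g h P Q R) (last a b c d e f g h P Q R)
    where
    first : ∀ a b c d e f g h P Q R →
      P * (a * e + b * g) * (a * e + b * g) + Q * (a * e + b * g) * (c * e + d * g) + R * (c * e + d * g) * (c * e + d * g)
      ≡ (P * a * a + Q * a * c + R * c * c) * e * e
        + (+ 2 * P * a * b + Q * (a * d + b * c) + + 2 * R * c * d) * e * g
        + (P * b * b + Q * b * d + R * d * d) * g * g
    first = solve-∀
    middle : ∀ a b c d e f g h P Q R →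
      + 2 * P * (a * e + b * g) * (a * f + b * h)
        + Q * ((a * e + b * g) * (c * f + d * h) + (a * f + b * h) * (c * e + d * g))
        + + 2 * R * (c * e + d * g) * (c * f + d * h)
      ≡ + 2 * (P * a * a + Q * a * c + R * c * c) * e * f
        + (+ 2 * P * a * b + Q * (a * d + b * c) + + 2 * R * c * d) * (e * h + f * g)
        + + 2 * (P * b * b + Q * b * d + R * d * d) * g * h
    middle = solve-∀
    last : ∀ a b c d e f g h P Q R →
      P * (a * f + b * h) * (a * f + b * h) + Q * (a * f + b * h) * (c * f + d * h) + R * (c * f + d * h) * (c * f + d * h)
      ≡ (P * a * a + Q * a * c + R * c * c) * f * f
        + (+ 2 * P * a * b + Q * (a * d + b * c) + + 2 * R * c * d) * f * h
        + (P * b * b + Q * b * d + R * d * d) * h * h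
    last = solve-∀

  disc-act : ∀ m f → disc (act m f) ≡ det m * det m * disc f
  disc-act (mat a b c d) (form P Q R) = identity a b c d P Q R
    where
    identity : ∀ a b c d P Q R →
      (+ 2 * P * a * b + Q * (a * d + b * c) + + 2 * R * c * d) * (+ 2 * P * a * b + Q * (a * d + b * c) + + 2 * R * c * d)
        - + 4 * (P * a * a + Q * a * c + R * c * c) * (P * b * b + Q * b * d + R * d * d)
      ≡ (a * d - b * c) * (a * d - b * c) * (Q * Q - + 4 * P * R)
    identity = solve-∀

  shiftʸ shiftˣ negateʸ swap mirror : Form → Form
  shiftʸ  (form P Q R) = form (P + Q + R) (Q + + 2 * R) R
  shiftˣ  (form P Q R) = form P (+ 2 * P + Q) (P + Q + R)
  negateʸ (form P Q R) = form P (- Q) R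
  swap    (form P Q R) = form R Q P
  mirror  (form P Q R) = form (- R) (- Q) (- P)

  eval-shiftʸ : ∀ f x y → eval f x (x + y) ≡ eval (shiftʸ f) x y
  eval-shiftʸ (form P Q R) = identity P Q R
    where
    identity : ∀ P Q R x y → P * x * x + Q * x * (x + y) + R * (x + y) * (x + y)
                             ≡ (P + Q + R) * x * x + (Q + + 2 * R) * x * y + R * y * y
    identity = solve-∀

  eval-shiftˣ : ∀ f x y → eval f (y + x) y ≡ eval (shiftˣ f) x y
  eval-shiftˣ (form P Q R) = identity P Q R
    where
    identity : ∀ P Q R x y → P * (y + x) * (y + x) + Q * (y + x) * y + R * y * y
                             ≡ P * x * x + (+ 2 * P + Q) * x * y + (P + Q + R) * y * y
    identity = solve-∀

  eval-negateʸ : ∀ f x y → eval f x (- y) ≡ eval (negateʸ f) x y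
  eval-negateʸ (form P Q R) = identity P Q R
    where
    identity : ∀ P Q R x y → P * x * x + Q * x * (- y) + R * (- y) * (- y) ≡ P * x * x + (- Q) * x * y + R * y * y
    identity = solve-∀

  eval-swap : ∀ f x y → eval f (- y) (- x) ≡ eval (swap f) x y
  eval-swap (form P Q R) = identity P Q R
    where
    identity : ∀ P Q R x y → P * (- y) * (- y) + Q * (- y) * (- x) + R * (- x) * (- x) ≡ R * x * x + Q * x * y + P * y * y
    identity = solve-∀

  eval-neg : ∀ f x y → eval f (- x) (- y) ≡ eval f x y
  eval-neg (form P Q R) = identity P Q R
    where
    identity : ∀ P Q R x y → P * (- x) * (- x) + Q * (- x) * (- y) + R * (- y) * (- y) ≡ P * x * x + Q * x * y + R * y * y
    identity = solve-∀

  eval-x0 : ∀ f x → eval f x (+ 0) ≡ A f * (x * x)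
  eval-x0 (form P Q R) = identity P Q R
    where
    identity : ∀ P Q R x → P * x * x + Q * x * + 0 + R * + 0 * + 0 ≡ P * (x * x)
    identity = solve-∀

  eval-0y : ∀ f y → eval f (+ 0) y ≡ C f * (y * y)
  eval-0y (form P Q R) = identity P Q R
    where
    identity : ∀ P Q R y → P * + 0 * + 0 + Q * + 0 * y + R * y * y ≡ R * (y * y)
    identity = solve-∀

  disc-shiftʸ : ∀ f → disc (shiftʸ f) ≡ disc f
  disc-shiftʸ (form P Q R) = identity P Q R
    where
    identity : ∀ P Q R → (Q + + 2 * R) * (Q + + 2 * R) - + 4 * (P + Q + R) * R ≡ Q * Q - + 4 * P * R
    identity = solve-∀

  disc-shiftˣ : ∀ f → disc (shiftˣ f) ≡ disc f
  disc-shiftˣ (form P Q R) = identity P Q R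
    where
    identity : ∀ P Q R → (+ 2 * P + Q) * (+ 2 * P + Q) - + 4 * P * (P + Q + R) ≡ Q * Q - + 4 * P * R
    identity = solve-∀

  disc-negateʸ : ∀ f → disc (negateʸ f) ≡ disc f
  disc-negateʸ (form P Q R) = identity P Q R
    where
    identity : ∀ P Q R → (- Q) * (- Q) - + 4 * P * R ≡ Q * Q - + 4 * P * R
    identity = solve-∀

  disc-swap : ∀ f → disc (swap f) ≡ disc f
  disc-swap (form P Q R) = identity P Q R
    where
    identity : ∀ P Q R → Q * Q - + 4 * R * P ≡ Q * Q - + 4 * P * R
    identity = solve-∀

  disc-mirror : ∀ f → disc (mirror f) ≡ disc f
  disc-mirror (form P Q R) = identity P Q R
    where
    identity : ∀ P Q R → (- Q) * (- Q) - + 4 * (- R) * (- P) ≡ Q * Q - + 4 * P * R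
    identity = solve-∀

  disc-ℕ : ∀ A B C D → disc (form (+ A) (+ B) (+ C)) ≡ + D → B ℕ.* B ≡ D ℕ.+ 4 ℕ.* A ℕ.* C
  disc-ℕ A B C D disc≡ = +-injective (begin
    + (B ℕ.* B)                                  ≡⟨ pos-* B B ⟩
    + B * + B                                    ≡⟨ add-back (+ B * + B) (+ 4 * + A * + C) ⟩
    (+ B * + B - + 4 * + A * + C) + + 4 * + A * + C ≡⟨ cong₂ _+_ disc≡ (sym +4AC≡) ⟩
    + D + + (4 ℕ.* A ℕ.* C)                      ≡⟨ pos-+ D (4 ℕ.* A ℕ.* C) ⟨
    + (D ℕ.+ 4 ℕ.* A ℕ.* C)                      ∎)
    where
    open ≡-Reasoning
    add-back : ∀ p q → p ≡ (p - q) + q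
    add-back = solve-∀
    +4AC≡ : + (4 ℕ.* A ℕ.* C) ≡ + 4 * + A * + C
    +4AC≡ = trans (pos-* (4 ℕ.* A) C) (cong (_* + C) (pos-* 4 A))

  ∼-trans : ∀ {f g h} → f ∼ g → g ∼ h → f ∼ h
  ∼-trans {f} (m , det-m , refl) (n , det-n , refl) =
    m · n , trans (det-· m n) (cong₂ _*_ det-m det-n) , act-· m n f

  ∼-sym : ∀ {f g} → f ∼ g → g ∼ f
  ∼-sym {f} (m , det-m , refl) = adjugate m , trans (det-adjugate m) det-m , (begin
    act (adjugate m) (act m f)  ≡⟨ act-· m (adjugate m) f ⟨
    act (m · adjugate m) f      ≡⟨ cong (λ n → act n f) (·-adjugate m det-m) ⟩
    act 1ₘ f                    ≡⟨ act-1ₘ f ⟩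
    f                           ∎)
    where open ≡-Reasoning

  ∼-disc : ∀ {f g} → f ∼ g → disc g ≡ disc f
  ∼-disc {f} (m , det-m , refl) = begin
    disc (act m f)              ≡⟨ disc-act m f ⟩
    det m * det m * disc f      ≡⟨ cong (λ D → D * D * disc f) det-m ⟩
    + 1 * + 1 * disc f          ≡⟨ *-identityˡ (disc f) ⟩
    disc f                      ∎
    where open ≡-Reasoning

  -- The leading coefficient of act m f is literally eval f (α m) (γ m).
  ∼-represents-leading : ∀ {f g} → f ∼ g → ∃₂ λ x y → eval f x y ≡ A g
  ∼-represents-leading (m , _ , refl) = α m , γ m , refl

module Descent where

  open import Defs
  open Arithmetic
  open Signs
  open Forms
  open import Data.Nat as ℕ using (ℕ; zero; suc; s≤s; z≤n)
  import Data.Nat.Properties as ℕ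
  open import Data.Integer hiding (suc)
  open import Data.Integer.Properties
  open import Data.Integer.Tactic.RingSolver using (solve-∀)
  open import Data.Product using (_,_; proj₁; proj₂)
  open import Data.Sum using (_⊎_; inj₁; inj₂; [_,_]′)
  open import Function using (_∘_)
  open import Relation.Binary using (tri<; tri≈; tri>)
  open import Relation.Binary.PropositionalEquality
  open import Relation.Nullary using (contradiction)

  <0*square≢1 : ∀ {i} q → i < + 0 → i * (+[1+ q ] * +[1+ q ]) ≢ + 1
  <0*square≢1 _ -<+ ()

  0<-eval≢1 : ∀ {P Q R} x y → + 0 < P → + 0 < Q → + 0 < R → eval (form P Q R) +[1+ x ] +[1+ y ] ≢ + 1
  0<-eval≢1 _ _ (+<+ ℕ.z<s) (+<+ ℕ.z<s) (+<+ ℕ.z<s) eq = ℕ.m+1+n≢0 _ (ℕ.suc-injective (+-injective eq))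

  <0-eval≢1 : ∀ {P Q R} x y → P < + 0 → Q < + 0 → R < + 0 → eval (form P Q R) +[1+ x ] +[1+ y ] ≢ + 1
  <0-eval≢1 _ _ -<+ -<+ -<+ ()

  fuel-right : ∀ u t n → suc u ℕ.+ suc (u ℕ.+ t) ℕ.≤ suc n → suc u ℕ.+ t ℕ.≤ n
  fuel-right u t n ≤suc-n = ℕ.≤-trans (ℕ.+-monoʳ-≤ (suc u) (ℕ.m≤n+m t u))
                                     (ℕ.≤-pred (subst (ℕ._≤ suc n) (ℕ.+-suc (suc u) (u ℕ.+ t)) ≤suc-n))

  fuel-left : ∀ v t n → suc (v ℕ.+ t) ℕ.+ suc v ℕ.≤ suc n → t ℕ.+ suc v ℕ.≤ n
  fuel-left v t n ≤suc-n = ℕ.≤-trans (ℕ.+-monoˡ-≤ (suc v) (ℕ.m≤n+m t v)) (ℕ.≤-pred ≤suc-n)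

  module _ (a : ℕ) (0<a : 0 ℕ.< a) where

    Δ : ℤ
    Δ = + (a ℕ.* a ℕ.+ 4)

    reduced-unit⇒B≡A+C+1 : ∀ {g} → ZagierReduced g → disc g ≡ Δ → A g ≡ + 1 ⊎ C g ≡ + 1 →
                           B g ≡ A g + C g + + 1
    reduced-unit⇒B≡A+C+1 {form _ (+ b) _} (_ , +<+ (s≤s {n = c} z≤n) , +<+ 2+c<b) disc≡ (inj₁ refl) =
      cong +_ (trans (b²≡a²+4+4c⇒b≡c+2 a b (suc c) b²≡ c+2≤b) (cong suc (ℕ.+-suc c 1)))
      where
      b²≡ : b ℕ.* b ≡ a ℕ.* a ℕ.+ 4 ℕ.+ 4 ℕ.* suc c
      b²≡ = disc-ℕ 1 b (suc c) _ disc≡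
      c+2≤b : suc c ℕ.+ 2 ℕ.≤ b
      c+2≤b = subst (ℕ._≤ b) (ℕ.+-comm 2 (suc c)) 2+c<b
    reduced-unit⇒B≡A+C+1 {form _ (+ b) _} (+<+ (s≤s {n = k} z≤n) , _ , +<+ 2+k<b) disc≡ (inj₂ refl) =
      cong +_ (trans (b²≡a²+4+4c⇒b≡c+2 a b (suc k) b²≡ k+2≤b) (cong suc (sym (ℕ.+-assoc k 1 1))))
      where
      b²≡ : b ℕ.* b ≡ a ℕ.* a ℕ.+ 4 ℕ.+ 4 ℕ.* suc k
      b²≡ = trans (disc-ℕ (suc k) b 1 _ disc≡) (cong (a ℕ.* a ℕ.+ 4 ℕ.+_) (ℕ.*-identityʳ (4 ℕ.* suc k)))
      k+2≤b : suc k ℕ.+ 2 ℕ.≤ b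
      k+2≤b = subst (ℕ._≤ b) (cong suc (sym (ℕ.+-suc k 1))) 2+k<b

    record Crossing (f : Form) : Set where
      constructor crossing
      field
        0<A    : + 0 < A f
        C<0    : C f < + 0
        disc≡Δ : disc f ≡ Δ
    open Crossing

    -- Otherwise B = - A - C and Δ = (A - C)² would be a square.
    crossing-sum≢0 : ∀ {f} → Crossing f → A f + B f + C f ≢ + 0
    crossing-sum≢0 {form α β γ} (crossing 0<α γ<0 disc≡) sum≡0 with 0<⇒+[1+] 0<α | <0⇒-[1+] γ<0
    ... | k , refl | l , refl = a²+4-nonsquare a (suc k ℕ.+ suc l) 0<a (+-injective (begin
      + ((suc k ℕ.+ suc l) ℕ.* (suc k ℕ.+ suc l))   ≡⟨ pos-* (suc k ℕ.+ suc l) _ ⟩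
      (α - γ) * (α - γ)                              ≡⟨ square-identity α γ ⟩
      (- α - γ) * (- α - γ) - + 4 * α * γ           ≡⟨ cong (λ b → b * b - + 4 * α * γ) β≡ ⟨
      β * β - + 4 * α * γ                            ≡⟨ disc≡ ⟩
      Δ                                              ∎))
      where
      open ≡-Reasoning
      square-identity : ∀ α γ → (α - γ) * (α - γ) ≡ (- α - γ) * (- α - γ) - + 4 * α * γ
      square-identity = solve-∀
      β≡ : β ≡ - α - γ
      β≡ = trans (isolate α β γ) (cong (λ s → s - α - γ) sum≡0)
        where
        isolate : ∀ α β γ → β ≡ (α + β + γ) - α - γ
        isolate = solve-∀

    -- shiftˣ f = (A, 2A + B, 1) is reduced, so its middle coefficient is A + 2.
    crossing-sum≡1 : ∀ {f} → Crossing f → A f + B f + C f ≡ + 1 → C f ≡ - + 1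
    crossing-sum≡1 {f@(form α β γ)} (crossing 0<α γ<0 disc≡) sum≡1 = begin
      γ                                         ≡⟨ isolate α β γ ⟩
      (α + (α + β + γ) + + 1) - (+ 2 * α + β) - + 1 ≡⟨ cong (λ b → b - (+ 2 * α + β) - + 1) B≡ ⟨
      (+ 2 * α + β) - (+ 2 * α + β) - + 1       ≡⟨ cancel (+ 2 * α + β) ⟩
      - + 1                                     ∎
      where
      open ≡-Reasoning
      isolate : ∀ α β γ → γ ≡ (α + (α + β + γ) + + 1) - (+ 2 * α + β) - + 1
      isolate = solve-∀
      cancel : ∀ b → b - b - + 1 ≡ - + 1
      cancel = solve-∀
      reduced : ZagierReduced (shiftˣ f)
      reduced = 0<α , subst (+ 0 <_) (sym sum≡1) (+<+ ℕ.z<s) ,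
                subst (α + (α + β + γ) <_) (sym (expand α β γ)) (i<i+j _ (neg-mono-< γ<0))
        where
        expand : ∀ α β γ → + 2 * α + β ≡ α + (α + β + γ) + - γ
        expand = solve-∀
      B≡ : + 2 * α + β ≡ α + (α + β + γ) + + 1
      B≡ = reduced-unit⇒B≡A+C+1 reduced (trans (disc-shiftˣ f) disc≡) (inj₂ sum≡1)

    crossing-sum≡-1 : ∀ {f} → Crossing f → A f + B f + C f ≡ - + 1 → A f ≡ + 1
    crossing-sum≡-1 {f@(form α β γ)} (crossing 0<α γ<0 disc≡) sum≡-1 =
      neg-injective (crossing-sum≡1 {mirror f} (crossing (neg-mono-< γ<0) (neg-mono-< 0<α) (trans (disc-mirror f) disc≡))
                                    (trans (negate α β γ) (cong -_ sum≡-1)))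
      where
      negate : ∀ α β γ → - γ + - β + - α ≡ - (α + β + γ)
      negate = solve-∀

    -- Euclid's algorithm on the representing vector (u, v), keeping the form crossing.
    crossing-represents-one : ∀ n {f} u v → u ℕ.+ v ℕ.≤ n → Crossing f → eval f (+ u) (+ v) ≡ + 1 →
                              A f ≡ + 1 ⊎ C f ≡ - + 1
    crossing-represents-one _ {f} u zero _ cf f≡1 =
      inj₁ (0<*≡1⇒≡1 (+ u * + u) (0<A cf) (trans (sym (eval-x0 f (+ u))) f≡1))
    crossing-represents-one _ {f} zero (suc v) _ cf f≡1 =
      contradiction (trans (sym (eval-0y f (+ suc v))) f≡1) (<0*square≢1 v (C<0 cf))
    crossing-represents-one (suc n) {f@(form α β γ)} (suc u) (suc v) u+v≤ cf@(crossing 0<α γ<0 disc≡) f≡1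
      with <-cmp (α + β + γ) (+ 0)
    ... | tri≈ _ sum≡0 _ = contradiction sum≡0 (crossing-sum≢0 cf)
    ... | tri> _ _ 0<sum with +-difference u v
    ...   | inj₁ (t , refl) =
            [ inj₂ ∘ crossing-sum≡1 cf , inj₂ ]′
            (crossing-represents-one n {shiftʸ f} (suc u) t (fuel-right u t n u+v≤)
                                     (crossing 0<sum γ<0 (trans (disc-shiftʸ f) disc≡))
                                     (trans (sym (eval-shiftʸ f (+ suc u) (+ t))) f≡1))
    ...   | inj₂ (t , refl) =
            contradiction (trans (sym (eval-shiftˣ f (+ suc t) (+ suc v))) f≡1) (0<-eval≢1 t v 0<α 0<2α+β 0<sum)
      where
      0<2α+β : + 0 < + 2 * α + β
      0<2α+β = subst (+ 0 <_) (sym (expand α β γ)) (0<+0< (0<+0< 0<α 0<sum) (neg-mono-< γ<0))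
        where
        expand : ∀ α β γ → + 2 * α + β ≡ α + (α + β + γ) + - γ
        expand = solve-∀
    crossing-represents-one (suc n) {f@(form α β γ)} (suc u) (suc v) u+v≤ cf@(crossing 0<α γ<0 disc≡) f≡1
      | tri< sum<0 _ _ with +-difference v u
    ...   | inj₁ (t , refl) =
            [ inj₁ , inj₁ ∘ crossing-sum≡-1 cf ]′
            (crossing-represents-one n {shiftˣ f} t (suc v) (fuel-left v t n u+v≤)
                                     (crossing 0<α sum<0 (trans (disc-shiftˣ f) disc≡))
                                     (trans (sym (eval-shiftˣ f (+ t) (+ suc v))) f≡1))
    ...   | inj₂ (t , refl) =
            contradiction (trans (sym (eval-shiftʸ f (+ suc u) (+ suc t))) f≡1) (<0-eval≢1 u t sum<0 β+2γ<0 γ<0)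
      where
      β+2γ<0 : β + + 2 * γ < + 0
      β+2γ<0 = subst (_< + 0) (sym (expand α β γ)) (<0+<0 (<0+<0 sum<0 (neg-mono-< 0<α)) γ<0)
        where
        expand : ∀ α β γ → β + + 2 * γ ≡ (α + β + γ) + - α + γ
        expand = solve-∀

    swap-reduced : ∀ {g} → ZagierReduced g → ZagierReduced (swap g)
    swap-reduced {form P Q R} (0<P , 0<R , P+R<Q) = 0<R , 0<P , subst (_< Q) (+-comm P R) P+R<Q

    -- Substituting (x, y) ↦ (y + x, - y) turns a reduced form into a crossing one.
    reduced-represents-one-at : ∀ {g} q t → ZagierReduced g → disc g ≡ Δ →
                                eval g (+ suc (q ℕ.+ t)) -[1+ q ] ≡ + 1 → B g ≡ A g + C g + + 1
    reduced-represents-one-at {g@(form P Q R)} q t reduced@(0<P , _ , P+R<Q) disc≡ g≡1 =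
      [ (λ P≡1 → reduced-unit⇒B≡A+C+1 reduced disc≡ (inj₁ P≡1)) , Q≡ ]′
      (crossing-represents-one _ {h} t (suc q) ℕ.≤-refl
                               (crossing 0<P sum<0 (trans (disc-shiftˣ (negateʸ g)) (trans (disc-negateʸ g) disc≡)))
                               (trans (sym (trans (eval-negateʸ g _ _) (eval-shiftˣ (negateʸ g) (+ t) (+ suc q)))) g≡1))
      where
      h = shiftˣ (negateʸ g)
      sum<0 : P + - Q + R < + 0
      sum<0 = subst₂ _<_ (rearrange P Q R) (+-inverseʳ Q) (+-monoˡ-< (- Q) P+R<Q)
        where
        rearrange : ∀ P Q R → P + R + - Q ≡ P + - Q + R
        rearrange = solve-∀
      Q≡ : P + - Q + R ≡ - + 1 → Q ≡ P + R + + 1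
      Q≡ sum≡-1 = trans (isolate P Q R) (trans (cong (λ s → P + R + + 1 - (s + + 1)) sum≡-1) (cancel (P + R + + 1)))
        where
        isolate : ∀ P Q R → Q ≡ P + R + + 1 - ((P + - Q + R) + + 1)
        isolate = solve-∀
        cancel : ∀ s → s - (- + 1 + + 1) ≡ s
        cancel = solve-∀

    reduced-represents-one⁺ : ∀ {g} p y → ZagierReduced g → disc g ≡ Δ → eval g (+ p) y ≡ + 1 →
                              B g ≡ A g + C g + + 1
    reduced-represents-one⁺ {g} zero y reduced@(_ , 0<C , _) disc≡ g≡1 =
      reduced-unit⇒B≡A+C+1 reduced disc≡ (inj₂ (0<*≡1⇒≡1 (y * y) 0<C (trans (sym (eval-0y g y)) g≡1)))
    reduced-represents-one⁺ {g} (suc p) (+ zero) reduced@(0<A , _) disc≡ g≡1 =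
      reduced-unit⇒B≡A+C+1 reduced disc≡ (inj₁ (0<*≡1⇒≡1 (+ suc p * + suc p) 0<A (trans (sym (eval-x0 g (+ suc p))) g≡1)))
    reduced-represents-one⁺ (suc p) +[1+ q ] (0<P , 0<R , P+R<Q) disc≡ g≡1 =
      contradiction g≡1 (0<-eval≢1 p q 0<P (<-trans (0<+0< 0<P 0<R) P+R<Q) 0<R)
    reduced-represents-one⁺ {g@(form P Q R)} (suc p) -[1+ q ] reduced disc≡ g≡1 with +-difference q p
    ... | inj₁ (t , refl) = reduced-represents-one-at q t reduced disc≡ g≡1
    ... | inj₂ (t , refl) =
          trans (reduced-represents-one-at {swap g} p (suc t) (swap-reduced reduced) (trans (disc-swap g) disc≡)
                                           (trans (sym (eval-swap g _ _)) g≡1))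
                (cong (_+ + 1) (+-comm R P))

    reduced-represents-one : ∀ {g} x y → ZagierReduced g → disc g ≡ Δ → eval g x y ≡ + 1 → B g ≡ A g + C g + + 1
    reduced-represents-one (+ p)     y = reduced-represents-one⁺ p y
    reduced-represents-one {g} -[1+ p ] y reduced disc≡ g≡1 = reduced-represents-one⁺ (suc p) (- y) reduced disc≡ (begin
      eval g (+ suc p) (- y)      ≡⟨ eval-neg g (+ suc p) (- y) ⟨
      eval g -[1+ p ] (- (- y))   ≡⟨ cong (eval g -[1+ p ]) (neg-involutive y) ⟩
      eval g -[1+ p ] y           ≡⟨ g≡1 ⟩
      + 1                         ∎)
      where open ≡-Reasoning

module ContinuedFractions where

  open import Defs using (cf)
  open import Data.Nat
  open import Data.Nat.Properties
  open import Data.Nat.Tactic.RingSolver using (solve-∀)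
  open import Data.Nat.Divisibility using (_∣_; ∣1⇒≡1; ∣m+n∣m⇒∣n; ∣-refl)
  open import Data.Nat.ListAction using (sum)
  open import Data.List.Base using (List; []; _∷_; length)
  open import Data.List.Relation.Unary.All using (All; []; _∷_)
  open import Data.Product using (_×_; _,_)
  open import Data.Sum using (inj₁; inj₂)
  open import Relation.Binary.PropositionalEquality
  open import Relation.Nullary using (contradiction)

  record Mat₂ : Set where
    constructor ⟨_,_,_,_⟩
    field
      m₁₁ m₁₂ m₂₁ m₂₂ : ℕ
  open Mat₂ public

  -- cf-matrix (q₁ ∷ … ∷ qₗ) is the product of the matrices (qᵢ 1; 1 0).
  cf-step : ℕ → Mat₂ → Mat₂
  cf-step q ⟨ p , p′ , r , r′ ⟩ = ⟨ q * p + r , q * p′ + r′ , p , p′ ⟩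

  cf-matrix : List ℕ → Mat₂
  cf-matrix []       = ⟨ 1 , 0 , 0 , 1 ⟩
  cf-matrix (q ∷ qs) = cf-step q (cf-matrix qs)

  cf≡first-column : ∀ qs → cf qs ≡ (m₁₁ (cf-matrix qs) , m₂₁ (cf-matrix qs))
  cf≡first-column []       = refl
  cf≡first-column (q ∷ qs) rewrite cf≡first-column qs = refl

  -- R · (x y; z w) · L, where R = (1 1; 0 1) and L = (1 0; 1 1).
  RNL : ℕ → ℕ → ℕ → ℕ → Mat₂
  RNL x y z w = ⟨ x + y + z + w , y + w , z + w , w ⟩

  -- What the argument uses about a product (x y; z w) of l factors R and L.
  record RLWord (x y z w l : ℕ) : Set where
    field
      det≡1       : x * w ≡ 1 + y * z
      l≤y+z       : l ≤ y + z
      x≡1⇒y+z≡l   : x ≡ 1 → y + z ≡ l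
  open RLWord public

  1≤x : ∀ {x y z w l} → RLWord x y z w l → 1 ≤ x
  1≤x {zero} word with det≡1 word
  ... | ()
  1≤x {suc _} _ = s≤s z≤n

  1≤w : ∀ {x y z w l} → RLWord x y z w l → 1 ≤ w
  1≤w {x} {w = zero} word = contradiction (trans (sym (*-zeroʳ x)) (det≡1 word)) λ ()
  1≤w {w = suc _} _ = s≤s z≤n

  m+n≡1⇒m≡1∧n≡0 : ∀ {m n} → 1 ≤ m → m + n ≡ 1 → m ≡ 1 × n ≡ 0
  m+n≡1⇒m≡1∧n≡0 {suc zero} {zero}  _ _  = refl , refl
  m+n≡1⇒m≡1∧n≡0 {suc zero} {suc _} _ ()
  m+n≡1⇒m≡1∧n≡0 {suc (suc _)} _ ()

  ε : RLWord 1 0 0 1 0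
  ε = record { det≡1 = refl ; l≤y+z = z≤n ; x≡1⇒y+z≡l = λ _ → refl }

  R^_· : ∀ {x y z w l} k → RLWord x y z w l → RLWord (x + k * z) (y + k * w) z w (l + k)
  R^_· {x} {y} {z} {w} {l} k word = record
    { det≡1     = trans (expand x z w k) (trans (cong (_+ k * z * w) (det≡1 word)) (collect y z w k))
    ; l≤y+z     = subst (l + k ≤_) (rearrange y z (k * w)) (+-mono-≤ (l≤y+z word) (m≤m*n k w {{≢-nonZero w≢0}}))
    ; x≡1⇒y+z≡l = equality
    }
    where
    expand : ∀ x z w k → (x + k * z) * w ≡ x * w + k * z * w
    expand = solve-∀
    collect : ∀ y z w k → 1 + y * z + k * z * w ≡ 1 + (y + k * w) * z
    collect = solve-∀
    rearrange : ∀ y z v → y + z + v ≡ y + v + z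
    rearrange = solve-∀
    w≢0 : w ≢ 0
    w≢0 = m<n⇒n≢0 (1≤w word)
    equality : x + k * z ≡ 1 → y + k * w + z ≡ l + k
    equality x+kz≡1 with m+n≡1⇒m≡1∧n≡0 (1≤x word) x+kz≡1
    ... | refl , kz≡0 with m*n≡0⇒m≡0∨n≡0 k kz≡0
    ...   | inj₁ refl = trans (cong (_+ z) (+-identityʳ y)) (trans (x≡1⇒y+z≡l word refl) (sym (+-identityʳ l)))
    ...   | inj₂ refl = begin
      y + k * w + 0  ≡⟨ cong (λ v → y + k * v + 0) w≡1 ⟩
      y + k * 1 + 0  ≡⟨ simplify y k ⟩
      y + 0 + k      ≡⟨ cong (_+ k) (x≡1⇒y+z≡l word refl) ⟩
      l + k          ∎
      where
      open ≡-Reasoning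
      w≡1 : w ≡ 1
      w≡1 = trans (sym (+-identityʳ w)) (trans (det≡1 word) (cong suc (*-zeroʳ y)))
      simplify : ∀ y k → y + k * 1 + 0 ≡ y + 0 + k
      simplify = solve-∀

  L^_· : ∀ {x y z w l} k → RLWord x y z w l → RLWord x y (z + k * x) (w + k * y) (l + k)
  L^_· {x} {y} {z} {w} {l} k word = record
    { det≡1     = trans (expand x y w k) (trans (cong (_+ k * x * y) (det≡1 word)) (collect x y z k))
    ; l≤y+z     = subst (l + k ≤_) (+-assoc y z (k * x)) (+-mono-≤ (l≤y+z word) (m≤m*n k x {{≢-nonZero x≢0}}))
    ; x≡1⇒y+z≡l = λ { refl →
        trans (sym (+-assoc y z (k * 1))) (cong₂ _+_ (x≡1⇒y+z≡l word refl) (*-identityʳ k)) }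
    }
    where
    expand : ∀ x y w k → x * (w + k * y) ≡ x * w + k * x * y
    expand = solve-∀
    collect : ∀ x y z k → 1 + y * z + k * x * y ≡ 1 + y * (z + k * x)
    collect = solve-∀
    x≢0 : x ≢ 0
    x≢0 = m<n⇒n≢0 (1≤x word)

  mat₂-cong : ∀ {a a′ b b′ c c′ d d′} → a ≡ a′ → b ≡ b′ → c ≡ c′ → d ≡ d′ →
              ⟨ a , b , c , d ⟩ ≡ ⟨ a′ , b′ , c′ , d′ ⟩
  mat₂-cong refl refl refl refl = refl

  record RNLDecomposition (qs : List ℕ) : Set where
    field
      x y z w l  : ℕ
      cf-matrix≡ : cf-matrix qs ≡ RNL x y z w
      word       : RLWord x y z w l
      sum≡       : sum qs ≡ l + 2

  -- (q₁ 1; 1 0)(q₂ 1; 1 0) = R^q₁ L^q₂, and R^q₁ L^q₂ · R N L = R · (R^(q₁-1) L^q₂ R N) · L.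
  rnl-decomposition : ∀ q₁ q₂ qs → All (1 ≤_) (q₁ ∷ q₂ ∷ qs) → 2 ∣ length qs → RNLDecomposition (q₁ ∷ q₂ ∷ qs)
  rnl-decomposition (suc a₁) (suc a₂) [] _ _ = record
    { cf-matrix≡ = mat₂-cong (e₁₁ a₁ a₂) (e₁₂ a₁ a₂) (e₂₁ a₂) (e₂₂ a₂)
    ; word       = R^ a₁ · (L^ a₂ · ε)
    ; sum≡       = e-sum a₁ a₂
    }
    where
    e₁₁ : ∀ a₁ a₂ → suc a₁ * (suc a₂ * 1 + 0) + 1
                    ≡ (1 + a₁ * (0 + a₂ * 1)) + (0 + a₁ * (1 + a₂ * 0)) + (0 + a₂ * 1) + (1 + a₂ * 0)
    e₁₁ = solve-∀
    e₁₂ : ∀ a₁ a₂ → suc a₁ * (suc a₂ * 0 + 1) + 0 ≡ (0 + a₁ * (1 + a₂ * 0)) + (1 + a₂ * 0)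
    e₁₂ = solve-∀
    e₂₁ : ∀ a₂ → suc a₂ * 1 + 0 ≡ (0 + a₂ * 1) + (1 + a₂ * 0)
    e₂₁ = solve-∀
    e₂₂ : ∀ a₂ → suc a₂ * 0 + 1 ≡ 1 + a₂ * 0
    e₂₂ = solve-∀
    e-sum : ∀ a₁ a₂ → suc a₁ + (suc a₂ + 0) ≡ 0 + a₂ + a₁ + 2
    e-sum = solve-∀
  rnl-decomposition _ _ (_ ∷ []) _ 2∣1 = contradiction (∣1⇒≡1 2∣1) λ ()
  rnl-decomposition zero _ _ (() ∷ _) _
  rnl-decomposition _ zero [] (_ ∷ () ∷ _) _
  rnl-decomposition (suc a₁) q₂ (r₁ ∷ r₂ ∷ qs) (_ ∷ _ ∷ positive) 2∣2+qs = record
    { cf-matrix≡ = trans (cong (λ M → cf-step (suc a₁) (cf-step q₂ M)) (cf-matrix≡ D))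
                         (mat₂-cong (e₁₁ a₁ q₂ x y z w) (e₁₂ a₁ q₂ y w) (e₂₁ q₂ x y z w) (e₂₂ q₂ y w))
    ; word       = R^ a₁ · (L^ q₂ · (R^ 1 · (word D)))
    ; sum≡       = trans (cong (λ s → suc a₁ + (q₂ + s)) (sum≡ D)) (e-sum a₁ q₂ l)
    }
    where
    D = rnl-decomposition r₁ r₂ qs positive (∣m+n∣m⇒∣n 2∣2+qs ∣-refl)
    open RNLDecomposition D using (x; y; z; w; l)
    open RNLDecomposition using (cf-matrix≡; word; sum≡)
    e₁₁ : ∀ a₁ q₂ x y z w → suc a₁ * (q₂ * (x + y + z + w) + (z + w)) + (x + y + z + w)
          ≡ (x + 1 * z + a₁ * (z + q₂ * (x + 1 * z))) + (y + 1 * w + a₁ * (w + q₂ * (y + 1 * w)))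
            + (z + q₂ * (x + 1 * z)) + (w + q₂ * (y + 1 * w))
    e₁₁ = solve-∀
    e₁₂ : ∀ a₁ q₂ y w → suc a₁ * (q₂ * (y + w) + w) + (y + w)
                        ≡ (y + 1 * w + a₁ * (w + q₂ * (y + 1 * w))) + (w + q₂ * (y + 1 * w))
    e₁₂ = solve-∀
    e₂₁ : ∀ q₂ x y z w → q₂ * (x + y + z + w) + (z + w) ≡ (z + q₂ * (x + 1 * z)) + (w + q₂ * (y + 1 * w))
    e₂₁ = solve-∀
    e₂₂ : ∀ q₂ y w → q₂ * (y + w) + w ≡ w + q₂ * (y + 1 * w)
    e₂₂ = solve-∀
    e-sum : ∀ a₁ q₂ l → suc a₁ + (q₂ + (l + 2)) ≡ l + 1 + q₂ + a₁ + 2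
    e-sum = solve-∀

  m+2≡1+m+1 : ∀ m → m + 2 ≡ 1 + m + 1
  m+2≡1+m+1 m = trans (sym (+-assoc m 1 1)) (cong (_+ 1) (+-comm m 1))

  length+2≤x+y+z+1 : ∀ {x y z w l} → RLWord x y z w l → l + 2 ≤ x + y + z + 1
  length+2≤x+y+z+1 {x} {y} {z} {l = l} word = begin
    l + 2                ≤⟨ +-monoˡ-≤ 2 (l≤y+z word) ⟩
    y + z + 2            ≡⟨ m+2≡1+m+1 (y + z) ⟩
    1 + (y + z) + 1      ≤⟨ +-monoˡ-≤ 1 (+-monoˡ-≤ (y + z) (1≤x word)) ⟩
    x + (y + z) + 1      ≡⟨ cong (_+ 1) (+-assoc x y z) ⟨
    x + y + z + 1        ∎
    where open ≤-Reasoning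

  length+2≡x+y+z+1⇒x≡1 : ∀ {x y z w l} → RLWord x y z w l → l + 2 ≡ x + y + z + 1 → x ≡ 1
  length+2≡x+y+z+1⇒x≡1 {x} {y} {z} {l = l} word l+2≡ = ≤-antisym (+-cancelʳ-≤ (y + z) x 1 x+y+z≤) (1≤x word)
    where
    open ≤-Reasoning
    x+y+z≤ : x + (y + z) ≤ 1 + (y + z)
    x+y+z≤ = +-cancelʳ-≤ 1 _ _ (begin
      x + (y + z) + 1   ≡⟨ cong (_+ 1) (+-assoc x y z) ⟨
      x + y + z + 1     ≡⟨ l+2≡ ⟨
      l + 2             ≤⟨ +-monoˡ-≤ 2 (l≤y+z word) ⟩
      y + z + 2         ≡⟨ m+2≡1+m+1 (y + z) ⟩
      1 + (y + z) + 1   ∎)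

module LowestTerms where

  open ContinuedFractions
  open import Data.Nat
  open import Data.Nat.Properties
  open import Data.Nat.Coprimality using (Coprime; coprime-divisor)
  open import Data.Nat.Divisibility using (_∣_; divides; ∣1⇒≡1; ∣m+n∣m⇒∣n; ∣-trans; m∣m*n; ∣-antisym)
  open import Data.Nat.Tactic.RingSolver using (solve-∀)
  open import Data.Product using (_×_; _,_; ∃-syntax; proj₁; proj₂)
  open import Relation.Binary.PropositionalEquality
  open import Relation.Binary using (tri<; tri≈; tri>)
  open import Relation.Nullary using (contradiction)

  unimodular⇒coprime : ∀ {p q r s} → p * q ≡ 1 + r * s → Coprime p r
  unimodular⇒coprime {p} {q} {r} {s} pq≡ {d} (d∣p , d∣r) = ∣1⇒≡1 (∣m+n∣m⇒∣n d∣rs+1 (∣-trans d∣r (m∣m*n s)))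
    where
    d∣rs+1 : d ∣ r * s + 1
    d∣rs+1 = subst (d ∣_) (trans pq≡ (+-comm 1 (r * s))) (∣-trans d∣p (m∣m*n q))

  coprime-difference : ∀ n A X Y d → .{{_ : NonZero n}} → Coprime n A → n * X ≡ n * Y + A * d →
                       ∃[ k ] d ≡ k * n × X ≡ Y + A * k
  coprime-difference n A X Y d coprime nX≡ with m≤n⇒∃[o]m+o≡n Y≤X
    where
    Y≤X : Y ≤ X
    Y≤X = *-cancelˡ-≤ n (subst (n * Y ≤_) (sym nX≡) (m≤m+n (n * Y) (A * d)))
  ... | e , refl = quotient (+-cancelˡ-≡ (n * Y) _ _ (trans (sym (*-distribˡ-+ n Y e)) nX≡))
    where
    quotient : n * e ≡ A * d → ∃[ k ] d ≡ k * n × Y + e ≡ Y + A * k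
    quotient ne≡ with coprime-divisor coprime (divides e (trans (sym ne≡) (*-comm n e)))
    ... | divides k refl = k , refl , cong (Y +_) (*-cancelˡ-≡ e (A * k) n (trans ne≡ (swap A k n)))
      where
      swap : ∀ A k n → A * (k * n) ≡ n * (A * k)
      swap = solve-∀

  -- (w, p) and (Q, C) both solve n·X = 1 + A·Y; they differ by a multiple of (A, n), which the bounds exclude.
  unimodular-solution-unique : ∀ n A C Q w p → .{{_ : NonZero n}} →
    n * w ≡ 1 + p * A → n * Q ≡ 1 + A * C → 1 ≤ C → w ≤ p → p ≤ n → A ≤ n → A + C < n + Q → p ≡ C × w ≡ Q
  unimodular-solution-unique n A C Q w p nw≡ nQ≡ 1≤C w≤p p≤n A≤n reduced with <-cmp p C
  ... | tri≈ _ refl _ = refl , *-cancelˡ-≡ w Q n (trans nw≡ (trans (cong suc (*-comm p A)) (sym nQ≡)))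
  ... | tri< p<C _ _ with m≤n⇒∃[o]m+o≡n p<C
  ...   | o , refl with coprime-difference n A Q w (suc o) (unimodular⇒coprime nQ≡) nQ≡nw+
    where
    identity : ∀ A p o → 1 + A * suc (p + o) ≡ 1 + p * A + A * suc o
    identity = solve-∀
    nQ≡nw+ : n * Q ≡ n * w + A * suc o
    nQ≡nw+ = trans nQ≡ (trans (identity A p o) (cong (_+ A * suc o) (sym nw≡)))
  ...     | zero  , () , _
  ...     | suc k , so≡ , refl = contradiction reduced (≤⇒≯ bound)
    where
    open ≤-Reasoning
    bound : n + (w + A * suc k) ≤ A + suc (p + o)
    bound = begin
      n + (w + A * suc k)    ≡⟨ expand n w A k ⟩
      n + A + w + A * k      ≤⟨ +-mono-≤ (+-monoʳ-≤ (n + A) w≤p) (*-monoˡ-≤ k A≤n) ⟩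
      n + A + p + n * k      ≡⟨ collect n A p k ⟩
      A + (p + suc k * n)    ≡⟨ cong (λ t → A + (p + t)) so≡ ⟨
      A + (p + suc o)        ≡⟨ cong (A +_) (+-suc p o) ⟩
      A + suc (p + o)        ∎
      where
      expand : ∀ n w A k → n + (w + A * suc k) ≡ n + A + w + A * k
      expand = solve-∀
      collect : ∀ n A p k → n + A + p + n * k ≡ A + (p + suc k * n)
      collect = solve-∀
  unimodular-solution-unique n A C Q w p nw≡ nQ≡ 1≤C w≤p p≤n A≤n reduced | tri> _ _ C<p with m≤n⇒∃[o]m+o≡n C<p
  ...   | o , refl with coprime-difference n A w Q (suc o) (unimodular⇒coprime nQ≡) nw≡nQ+
    where
    identity : ∀ A C o → 1 + suc (C + o) * A ≡ 1 + A * C + A * suc o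
    identity = solve-∀
    nw≡nQ+ : n * w ≡ n * Q + A * suc o
    nw≡nQ+ = trans nw≡ (trans (identity A C o) (cong (_+ A * suc o) (sym nQ≡)))
  ...     | zero  , () , _
  ...     | suc k , so≡ , _ = contradiction p≤n (<⇒≱ n<p)
    where
    open ≤-Reasoning
    n<p : n < suc (C + o)
    n<p = begin-strict
      n            ≤⟨ m≤m+n n (k * n) ⟩
      suc k * n    ≡⟨ so≡ ⟨
      1 + o        ≤⟨ +-monoˡ-≤ o 1≤C ⟩
      C + o        <⟨ n<1+n (C + o) ⟩
      suc (C + o)  ∎

  -- n/r = (x+y+z+w)/(z+w) and P/A = (a+Q)/A are both in lowest terms, so n·A = r·P forces n = P and A = r.
  rnl-coordinates : ∀ a A C Q {x y z w l} → RLWord x y z w l →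
                    (a + Q) * Q ≡ 1 + A * C → 1 ≤ C → A + C < a + 2 * Q → (x + y + z + w) * A ≡ (z + w) * (a + Q) →
                    a ≡ x + y + z × A ≡ z + w × C ≡ y + w × Q ≡ w
  rnl-coordinates a A C Q {x} {y} {z} {w} word PQ≡ 1≤C reduced nA≡rP =
    a≡ , A≡r , sym (proj₁ solution) , sym (proj₂ solution)
    where
    n = x + y + z + w
    P = a + Q
    r = z + w
    x≤n : x ≤ n
    x≤n = subst (x ≤_) (rearrange x y z w) (m≤m+n x (y + z + w))
      where
      rearrange : ∀ x y z w → x + (y + z + w) ≡ x + y + z + w
      rearrange = solve-∀
    y+w≤n : y + w ≤ n
    y+w≤n = subst (y + w ≤_) (rearrange x y z w) (m≤m+n (y + w) (x + z))
      where
      rearrange : ∀ x y z w → y + w + (x + z) ≡ x + y + z + w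
      rearrange = solve-∀
    r≤n : r ≤ n
    r≤n = subst (r ≤_) (rearrange x y z w) (m≤m+n r (x + y))
      where
      rearrange : ∀ x y z w → z + w + (x + y) ≡ x + y + z + w
      rearrange = solve-∀
    instance
      n-nonZero : NonZero n
      n-nonZero = >-nonZero (≤-trans (1≤x word) x≤n)
    nw≡ : n * w ≡ 1 + r * (y + w)
    nw≡ = trans (expand x y z w) (trans (cong (_+ (y + z + w) * w) (det≡1 word)) (collect y z w))
      where
      expand : ∀ x y z w → (x + y + z + w) * w ≡ x * w + (y + z + w) * w
      expand = solve-∀
      collect : ∀ y z w → 1 + y * z + (y + z + w) * w ≡ 1 + (z + w) * (y + w)
      collect = solve-∀
    n≡P : n ≡ P
    n≡P = ∣-antisym (coprime-divisor (unimodular⇒coprime {r = r} nw≡) (divides A (trans (sym nA≡rP) (*-comm n A))))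
                    (coprime-divisor (unimodular⇒coprime {r = A} PQ≡) (divides r (trans (*-comm A n) nA≡rP)))
    A≡r : A ≡ r
    A≡r = *-cancelˡ-≡ A r n (trans nA≡rP (trans (cong (r *_) (sym n≡P)) (*-comm r n)))
    a+2Q≡n+Q : a + 2 * Q ≡ n + Q
    a+2Q≡n+Q = trans (expand a Q) (cong (_+ Q) (sym n≡P))
      where
      expand : ∀ a Q → a + 2 * Q ≡ a + Q + Q
      expand = solve-∀
    solution : y + w ≡ C × w ≡ Q
    solution = unimodular-solution-unique n A C Q w (y + w)
      (trans nw≡ (cong (λ t → 1 + t) (trans (*-comm r (y + w)) (cong ((y + w) *_) (sym A≡r)))))
      (trans (cong (_* Q) n≡P) PQ≡) 1≤C (m≤n+m w y) y+w≤n (subst (_≤ n) (sym A≡r) r≤n)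
      (subst (A + C <_) a+2Q≡n+Q reduced)
    a≡ : a ≡ x + y + z
    a≡ = +-cancelʳ-≡ w a (x + y + z) (trans (cong (a +_) (proj₂ solution)) (sym n≡P))

module PrincipalClass where

  open import Defs
  open Forms
  import Data.Nat as ℕ
  open import Data.Integer
  open import Data.Integer.Properties using (pos-+; pos-*)
  open import Data.Integer.Tactic.RingSolver using (solve-∀)
  open import Data.Product using (_,_)
  open import Relation.Binary.PropositionalEquality

  -- The reduced form with x = 1, i.e. N = (1 y; z 1 + y z), is carried to the principal one by (1+z  z; -z  1-z).
  unit-corner∼principal : ∀ y z {w a} → w ≡ 1 ℕ.+ y ℕ.* z → a ≡ 1 ℕ.+ y ℕ.+ z →
                          form (+ (z ℕ.+ w)) (+ (a ℕ.+ 2 ℕ.* w)) (+ (y ℕ.+ w)) ∼ principal a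
  unit-corner∼principal y z refl refl = T , det-T (+ z) , (begin
    act T (form (+ (z ℕ.+ w)) (+ (1 ℕ.+ y ℕ.+ z ℕ.+ 2 ℕ.* w)) (+ (y ℕ.+ w)))
      ≡⟨ cong (act T) (form-cong +A≡ +B≡ +C≡) ⟩
    act T (form (Z + W) (+ 1 + Y + Z + + 2 * W) (Y + W))
      ≡⟨ form-cong (first Y Z) (middle Y Z) (last Y Z) ⟩
    form (+ 1) (+ 1 + Y + Z + + 2) (+ 1 + Y + Z)
      ≡⟨ form-cong refl +a+2≡ +a≡ ⟨
    principal (1 ℕ.+ y ℕ.+ z)
      ∎)
    where
    open ≡-Reasoning
    w = 1 ℕ.+ y ℕ.* z
    Y = + y
    Z = + z
    W = + 1 + Y * Z
    T = mat (+ 1 + Z) Z (- Z) (+ 1 - Z)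
    det-T : ∀ Z → (+ 1 + Z) * (+ 1 - Z) - Z * (- Z) ≡ + 1
    det-T = solve-∀
    +w≡ : + w ≡ W
    +w≡ = trans (pos-+ 1 (y ℕ.* z)) (cong (_+_ (+ 1)) (pos-* y z))
    +a≡ : + (1 ℕ.+ y ℕ.+ z) ≡ + 1 + Y + Z
    +a≡ = trans (pos-+ (1 ℕ.+ y) z) (cong (_+ Z) (pos-+ 1 y))
    +a+2≡ : + (1 ℕ.+ y ℕ.+ z ℕ.+ 2) ≡ + 1 + Y + Z + + 2
    +a+2≡ = trans (pos-+ (1 ℕ.+ y ℕ.+ z) 2) (cong (_+ + 2) +a≡)
    +A≡ : + (z ℕ.+ w) ≡ Z + W
    +A≡ = trans (pos-+ z w) (cong (_+_ Z) +w≡)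
    +B≡ : + (1 ℕ.+ y ℕ.+ z ℕ.+ 2 ℕ.* w) ≡ + 1 + Y + Z + + 2 * W
    +B≡ = trans (pos-+ (1 ℕ.+ y ℕ.+ z) (2 ℕ.* w)) (cong₂ _+_ +a≡ (trans (pos-* 2 w) (cong (_*_ (+ 2)) +w≡)))
    +C≡ : + (y ℕ.+ w) ≡ Y + W
    +C≡ = trans (pos-+ y w) (cong (_+_ Y) +w≡)
    first : ∀ Y Z → let W = + 1 + Y * Z ; P = Z + W ; Q = + 1 + Y + Z + + 2 * W ; R = Y + W in
      P * (+ 1 + Z) * (+ 1 + Z) + Q * (+ 1 + Z) * (- Z) + R * (- Z) * (- Z) ≡ + 1
    first = solve-∀
    middle : ∀ Y Z → let W = + 1 + Y * Z ; P = Z + W ; Q = + 1 + Y + Z + + 2 * W ; R = Y + W in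
      + 2 * P * (+ 1 + Z) * Z + Q * ((+ 1 + Z) * (+ 1 - Z) + Z * (- Z)) + + 2 * R * (- Z) * (+ 1 - Z) ≡ + 1 + Y + Z + + 2
    middle = solve-∀
    last : ∀ Y Z → let W = + 1 + Y * Z ; P = Z + W ; Q = + 1 + Y + Z + + 2 * W ; R = Y + W in
      P * Z * Z + Q * Z * (+ 1 - Z) + R * (+ 1 - Z) * (+ 1 - Z) ≡ + 1 + Y + Z
    last = solve-∀


module ZagierCoordinates where

  open import Defs
  open Arithmetic
  open Signs
  open Forms
  open PrincipalClass
  open ContinuedFractions
  open LowestTerms
  open import Data.Nat
  open import Data.Nat.Properties
  open import Data.Nat.Divisibility using (_∣_; ∣1⇒≡1; ∣m+n∣m⇒∣n; ∣-refl)
  open import Data.Nat.Tactic.RingSolver using (solve-∀)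
  open import Data.Nat.ListAction using (sum)
  open import Data.Integer as ℤ using (ℤ; +_; +[1+_]; +<+)
  import Data.Integer.Properties as ℤ
  open import Data.List.Base using (List; []; _∷_; length)
  open import Data.List.Relation.Unary.All using (All)
  open import Data.Product using (_×_; _,_; proj₁; proj₂)
  open import Relation.Binary.PropositionalEquality
  open import Relation.Nullary using (contradiction)

  IsPsi⇒cf-matrix : ∀ a g qs → IsPsi a g qs →
                    All (1 ≤_) qs × 2 ∣ length qs ×
                    + m₁₁ (cf-matrix qs) ℤ.* (+ 2 ℤ.* A g) ≡ + m₂₁ (cf-matrix qs) ℤ.* (+ a ℤ.+ B g)
  IsPsi⇒cf-matrix a g qs psi with cf qs | cf≡first-column qs
  ... | _ | refl = psi

  psi-equation : ∀ a A′ B′ C qs → IsPsi a (form +[1+ A′ ] +[1+ B′ ] C) qs →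
                 m₁₁ (cf-matrix qs) * (2 * suc A′) ≡ m₂₁ (cf-matrix qs) * (a + suc B′)
  psi-equation a A′ B′ C qs psi = ℤ.+-injective (begin
    + (m₁₁ (cf-matrix qs) * (2 * suc A′))                  ≡⟨ ℤ.pos-* (m₁₁ (cf-matrix qs)) (2 * suc A′) ⟩
    + m₁₁ (cf-matrix qs) ℤ.* + (2 * suc A′)                ≡⟨ proj₂ (proj₂ (IsPsi⇒cf-matrix a (form +[1+ A′ ] +[1+ B′ ] C) qs psi)) ⟩
    + m₂₁ (cf-matrix qs) ℤ.* + (a + suc B′)                ≡⟨ ℤ.pos-* (m₂₁ (cf-matrix qs)) (a + suc B′) ⟨
    + (m₂₁ (cf-matrix qs) * (a + suc B′))                  ∎)
    where open ≡-Reasoning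

  psi-decomposition : ∀ a A′ B C qs → IsPsi a (form +[1+ A′ ] B C) qs → RNLDecomposition qs
  psi-decomposition _ _ _ _ []       (_ , _ , ())
  psi-decomposition _ _ _ _ (_ ∷ []) (_ , 2∣1 , _) = contradiction (∣1⇒≡1 2∣1) λ ()
  psi-decomposition a A′ B C (q₁ ∷ q₂ ∷ qs) psi with IsPsi⇒cf-matrix a (form +[1+ A′ ] B C) (q₁ ∷ q₂ ∷ qs) psi
  ... | positive , even , _ = rnl-decomposition q₁ q₂ qs positive (∣m+n∣m⇒∣n even ∣-refl)

  -- x y z w are the entries of N in cf-matrix qs = R N L.
  record Coordinates (a : ℕ) (g : Form) (qs : List ℕ) : Set where
    field
      x y z w l : ℕ
      word      : RLWord x y z w l
      sum≡      : sum qs ≡ l + 2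
      a≡        : a ≡ x + y + z
      g≡        : g ≡ form (+ (z + w)) (+ (a + 2 * w)) (+ (y + w))

  coordinates : ∀ {a g} qs → ZagierReduced g → disc g ≡ + (a * a + 4) → IsPsi a g qs → Coordinates a g qs
  coordinates {a} {form P Q R} qs (0<P , 0<R , P+R<Q) disc≡ psi
    with 0<⇒+[1+] 0<P | 0<⇒+[1+] 0<R | 0<⇒+[1+] (ℤ.<-trans (0<+0< 0<P 0<R) P+R<Q)
  ... | A′ , refl | C′ , refl | B′ , refl = record
    { x = x ; y = y ; z = z ; w = w ; l = l ; word = word ; sum≡ = sum≡ ; a≡ = a≡
    ; g≡ = form-cong (cong +_ A≡) (cong +_ (trans b≡ (cong (λ t → a + 2 * t) Q≡w))) (cong +_ C≡)
    }
    where
    open RNLDecomposition (psi-decomposition a A′ +[1+ B′ ] +[1+ C′ ] qs psi)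
    parametrisation = b²≡a²+4n⇒b≡a+2q a (suc B′) (1 + suc A′ * suc C′)
                        (trans (disc-ℕ (suc A′) (suc B′) (suc C′) _ disc≡) (regroup a (suc A′) (suc C′)))
      where
      regroup : ∀ a A C → a * a + 4 + 4 * A * C ≡ a * a + 4 * (1 + A * C)
      regroup = solve-∀
    Q′ = proj₁ parametrisation
    b≡ = proj₁ (proj₂ parametrisation)
    nA≡rP : (x + y + z + w) * suc A′ ≡ (z + w) * (a + Q′)
    nA≡rP = *-cancelˡ-≡ _ _ 2 (begin
      2 * ((x + y + z + w) * suc A′)      ≡⟨ double (x + y + z + w) (suc A′) ⟩
      (x + y + z + w) * (2 * suc A′)      ≡⟨ cong (_* (2 * suc A′)) (cong m₁₁ cf-matrix≡) ⟨
      m₁₁ (cf-matrix qs) * (2 * suc A′)   ≡⟨ psi-equation a A′ B′ +[1+ C′ ] qs psi ⟩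
      m₂₁ (cf-matrix qs) * (a + suc B′)   ≡⟨ cong₂ (λ r b → r * (a + b)) (cong m₂₁ cf-matrix≡) b≡ ⟩
      (z + w) * (a + (a + 2 * Q′))        ≡⟨ halve (z + w) a Q′ ⟩
      2 * ((z + w) * (a + Q′))            ∎)
      where
      open ≡-Reasoning
      double : ∀ n A → 2 * (n * A) ≡ n * (2 * A)
      double = solve-∀
      halve : ∀ r a Q → r * (a + (a + 2 * Q)) ≡ 2 * (r * (a + Q))
      halve = solve-∀
    coordinates′ = rnl-coordinates a (suc A′) (suc C′) Q′ word (proj₂ (proj₂ parametrisation)) (s≤s z≤n)
                     (subst (suc A′ + suc C′ <_) b≡ (ℤ.drop‿+<+ P+R<Q)) nA≡rP
    a≡ = proj₁ coordinates′
    A≡ = proj₁ (proj₂ coordinates′)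
    C≡ = proj₁ (proj₂ (proj₂ coordinates′))
    Q≡w = proj₂ (proj₂ (proj₂ coordinates′))

  module _ {a g qs} (c : Coordinates a g qs) where
    open Coordinates c

    sum≤a+1 : sum qs ≤ a + 1
    sum≤a+1 = subst₂ _≤_ (sym sum≡) (cong (_+ 1) (sym a≡)) (length+2≤x+y+z+1 word)

    sum≡a+1⇒x≡1 : sum qs ≡ a + 1 → x ≡ 1
    sum≡a+1⇒x≡1 sum≡a+1 = length+2≡x+y+z+1⇒x≡1 word (trans (sym sum≡) (trans sum≡a+1 (cong (_+ 1) a≡)))

    x≡1⇒sum≡a+1 : x ≡ 1 → sum qs ≡ a + 1
    x≡1⇒sum≡a+1 refl = begin
      sum qs           ≡⟨ sum≡ ⟩
      l + 2            ≡⟨ cong (_+ 2) (x≡1⇒y+z≡l word refl) ⟨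
      y + z + 2        ≡⟨ m+2≡1+m+1 (y + z) ⟩
      1 + (y + z) + 1  ≡⟨ cong (_+ 1) (trans (sym (+-assoc 1 y z)) (sym a≡)) ⟩
      a + 1            ∎
      where open ≡-Reasoning

    x≡1⇒g∼principal : x ≡ 1 → g ∼ principal a
    x≡1⇒g∼principal refl =
      subst (_∼ principal a) (sym g≡) (unit-corner∼principal y z (trans (sym (+-identityʳ w)) (det≡1 word)) a≡)

    B≡A+C+1⇒x≡1 : B g ≡ A g ℤ.+ C g ℤ.+ + 1 → x ≡ 1
    B≡A+C+1⇒x≡1 B≡ = +-cancelʳ-≡ (y + z + 2 * w) x 1 (begin
      x + (y + z + 2 * w)        ≡⟨ regroup x y z w ⟩
      x + y + z + 2 * w          ≡⟨ cong (_+ 2 * w) a≡ ⟨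
      a + 2 * w                  ≡⟨ ℤ.+-injective (trans (sym (cong B g≡)) (trans B≡ (cong A+C+1 g≡))) ⟩
      z + w + (y + w) + 1        ≡⟨ regroup′ y z w ⟩
      1 + (y + z + 2 * w)        ∎)
      where
      open ≡-Reasoning
      regroup : ∀ x y z w → x + (y + z + 2 * w) ≡ x + y + z + 2 * w
      regroup = solve-∀
      regroup′ : ∀ y z w → z + w + (y + w) + 1 ≡ 1 + (y + z + 2 * w)
      regroup′ = solve-∀
      A+C+1 : Form → ℤ
      A+C+1 h = A h ℤ.+ C h ℤ.+ + 1

open import Defs
open import Data.Nat using (ℕ; _+_; _*_; _≤_; _<_)
open import Data.Integer using (+_)
open import Data.List using (List)
open import Data.Nat.ListAction using (sum)
open import Data.Product using (_×_; _,_)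
open import Function using (_∘_)
open import Function.Bundles using (_⇔_; mk⇔)
open import Relation.Binary.PropositionalEquality using (_≡_; trans)
open Forms using (∼-trans; ∼-sym; ∼-disc; ∼-represents-leading)
open Descent using (reduced-represents-one)
open ZagierCoordinates

lemma2 : (a : ℕ) → 0 < a → (f : Form) → disc f ≡ + (a * a + 4)
       → (g : Form) → ZagierReduced g → f ∼ g
       → (qs : List ℕ) → IsPsi a g qs
       → (sum qs ≤ a + 1) × ((sum qs ≡ a + 1) ⇔ (f ∼ principal a))
lemma2 a 0<a f disc-f g reduced f∼g qs psi = sum≤a+1 c , mk⇔ sufficient necessary
  where
  disc-g = trans (∼-disc {f} {g} f∼g) disc-f
  c = coordinates qs reduced disc-g psi
  sufficient : sum qs ≡ a + 1 → f ∼ principal a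
  sufficient = ∼-trans {f} {g} f∼g ∘ x≡1⇒g∼principal c ∘ sum≡a+1⇒x≡1 c
  necessary : f ∼ principal a → sum qs ≡ a + 1
  necessary f∼principal with ∼-represents-leading {g} (∼-trans {g} {f} (∼-sym {f} f∼g) f∼principal)
  ... | u , v , g[u,v]≡1 =
    x≡1⇒sum≡a+1 c (B≡A+C+1⇒x≡1 c (reduced-represents-one a 0<a u v reduced disc-g g[u,v]≡1))
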